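{- Let $S$ be a variable preserving term equation system over a ranked alphabet $\Sigma$ and let $p,q\in T_\Sigma$. If Procedure 1 (described in the context), run on input $S,p,q$, halts and outputs 'yes', then $p\Leftrightarrow^*_S q$. If it halts and outputs 'no', then $(p,q)\notin\Leftrightarrow^*_S$.
   Context: Notation. $\Sigma$ is a ranked alphabet: a finite set of function symbols, each with a rank $m\ge 0$; $\Sigma_m$ is the set of symbols of rank $m$. $T_\Sigma$ is the set of ground terms over $\Sigma$. $X=\{x_1,x_2,\dots\}$ is a set of variables, $X_m=\{x_1,\dots,x_m\}$, and $T_\Sigma(X_m)$ is the set of terms over $\Sigma$ with variables in $X_m$. For $t\in T_\Sigma(X_m)$ and terms $t_1,\dots,t_m$, $t[t_1,\dots,t_m]$ is obtained from $t$ by replacing every occurrence of $x_j$ by $t_j$. A context is a term $u\in T_\Sigma(X_1)$ in which $x_1$ occurs exactly once; $u[s]$ is $u$ with $x_1$ replaced by $s$. Term equation systems. A term equation system (TES) $S$ over $\Sigma$ is a finite set of equations $l\approx r$ between terms over $\Sigma$ with variables in $X$. $S$ is variable preserving if in every equation exactly the same variables occur in $l$ and in $r$; each such equation is written with $l,r\in T_\Sigma(X_m)$. For ground terms $s,t$, $s\Leftrightarrow_S t$ means there are an equation $l\approx r$ of $S$ ($l,r\in T_\Sigma(X_m)$), a context $u$ and ground terms $u_1,\dots,u_m$ with $\{s,t\}=\{u[l[u_1,\dots,u_m]],u[r[u_1,\dots,u_m]]\}$; $\Leftrightarrow^*_S$ is its reflexive transitive closure. A GTES is a finite set $E$ of equations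 between ground terms; $\Leftrightarrow^*_E$ is defined in the same way. Congruence class computing tree automaton associated with a GTES $E$ and ground terms $p,q$: $T$ is the set of all subterms of $p$, $q$ and of both sides of all equations of $E$; $\Theta=\Leftrightarrow^*_E\cap(T\times T)$ with classes $[t]_\Theta$; states $A=\{[t]_\Theta:t\in T\}$ (new constants); rules $R=\{f([t_1]_\Theta,\dots,[t_m]_\Theta)\to[f(t_1,\dots,t_m)]_\Theta : f(t_1,\dots,t_m)\in T\}$; $\to^*_R$ is rewriting with $R$ on terms over $\Sigma\cup A$. For each $a\in A$ a ground term $tree(a)\in T_\Sigma$ with $tree(a)\to^*_R a$ is fixed (computed by a fixed deterministic effective algorithm). The automaton reaches $b$ starting from $c$ if $u[c]\to^*_R b$ for some context $u$ ($u=x_1$ allowed). Sequences for variable preserving $S$ and $p,q$: $W_1$ is the set of ground equations $l[u_1,\dots,u_m]\approx r[u_1,\dots,u_m]$ ($l\approx r\in S$, $u_j\in T_\Sigma$) such that $l[u_1,\dots,u_m]$ or $r[u_1,\dots,u_m]$ is a subterm of $p$ or of $q$. With $A_i,R_i,\Theta_i,tree_i$ the data of the automaton associated with $W_i$ and $p,q$, $W_{i+1}$ consists of $W_i$ together with every equation $l[tree_i(a_1),\dots,tree_i(a_m)]\approx r[tree_i(a_1),\dots,tree_i(a_m)]$ with $l\approx r\in S$, $a_1,\dots,a_m,a\in A_i$ such that (1) $l[a_1,\dots,a_m]\to^*_{R_i}a$ or $r[a_1,\dots,a_m]\to^*_{R_i}a$, (2) the automaton reaches $[p]_{\Theta_i}$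 or $[q]_{\Theta_i}$ starting from $a$, (3) the pair of the two sides is not in $\Leftrightarrow^*_{W_i}$. $P_i$ is defined in the same way with only $p$: in $P_1$ the instantiated side must be a subterm of $p$; for $P_{i+1}$ the automaton is the one associated with $P_i$ and $p,q$, (2) reads "reaches $[p]_{\Theta_i}$ from $a$", and (3) uses $\Leftrightarrow^*_{P_i}$. $Q_i$ is defined symmetrically with $q$ in place of $p$. Procedure 1 (input $S,p,q$): $i:=1$; compute $W_1,P_1,Q_1$; if $p\Leftrightarrow^*_{W_1}q$ output 'yes' and halt. Loop: $i:=i+1$; compute $W_i,P_i,Q_i$; if $p\Leftrightarrow^*_{W_i}q$ output 'yes' and halt; if $W_i=W_{i-1}$ or $P_i=P_{i-1}$ or $Q_i=Q_{i-1}$ output 'no' and halt; repeat. -}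

module Defs where

open import Data.Nat using (ℕ; zero; suc; _<_; _≤_)
open import Data.Fin using (Fin)
open import Data.Vec using (Vec; []; _∷_; lookup; _[_]≔_)
import Data.Vec as Vec
open import Data.Empty using (⊥)
open import Data.Product using (Σ; _×_; _,_; proj₁; proj₂)
open import Data.Sum using (_⊎_)
open import Data.List using (List)
open import Data.List.Membership.Propositional using (_∈_)
open import Relation.Nullary using (¬_)
open import Relation.Binary.PropositionalEquality using (_≡_)
open import Relation.Binary.Construct.Closure.ReflexiveTransitive using (Star)

record Signature : Set where
  field
    nsym : ℕ
    rank : Fin nsym → ℕ

module _ (Sig : Signature) where
  open Signature Sig

  data Tm (V : Set) : Set where
    var  : V → Tm V
    node : (f : Fin nsym) → Vec (Tm V) (rank f) → Tm V

  Ground : Set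
  Ground = Tm ⊥

  -- Terms with variables x_1, x_2, ... (variable x_{k+1} is  var k).
  OpenTerm : Set
  OpenTerm = Tm ℕ

  mutual
    _⟨_⟩ : ∀ {V W : Set} → Tm V → (V → Tm W) → Tm W
    var x ⟨ σ ⟩ = σ x
    node f ts ⟨ σ ⟩ = node f (substs ts σ)

    substs : ∀ {V W : Set} {n} → Vec (Tm V) n → (V → Tm W) → Vec (Tm W) n
    substs [] σ = []
    substs (t ∷ ts) σ = (t ⟨ σ ⟩) ∷ substs ts σ

  embed : ∀ {V : Set} → Ground → Tm V
  embed t = t ⟨ (λ ()) ⟩

  -- Contexts: terms with exactly one occurrence of the hole x_1.
  data Ctx (V : Set) : Set where
    hole : Ctx V
    node : (f : Fin nsym) (i : Fin (rank f)) (ts : Vec (Tm V) (rank f)) → Ctx V → Ctx V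

  plug : ∀ {V : Set} → Ctx V → Tm V → Tm V
  plug hole s = s
  plug (node f i ts c) s = node f (ts [ i ]≔ plug c s)

  liftCtx : ∀ {V : Set} → Ctx ⊥ → Ctx V
  liftCtx hole = hole
  liftCtx (node f i ts c) = node f i (Vec.map embed ts) (liftCtx c)

  data Occurs {V : Set} (x : V) : Tm V → Set where
    here  : Occurs x (var x)
    there : ∀ {f ts} (i : Fin (rank f)) → Occurs x (lookup ts i) → Occurs x (node f ts)

  data Sub {V : Set} (s : Tm V) : Tm V → Set where
    here  : Sub s s
    there : ∀ {f ts} (i : Fin (rank f)) → Sub s (lookup ts i) → Sub s (node f ts)

  TES : Set
  TES = List (OpenTerm × OpenTerm)

  VariablePreserving : TES → Set
  VariablePreserving S = ∀ {l r} → (l , r) ∈ S → ∀ (x : ℕ) →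
    (Occurs x l → Occurs x r) × (Occurs x r → Occurs x l)

  TStep : TES → Ground → Ground → Set
  TStep S s t = Σ (OpenTerm × OpenTerm) λ lr → lr ∈ S ×
    Σ (Ctx ⊥) λ u → Σ (ℕ → Ground) λ σ →
      (s ≡ plug u (proj₁ lr ⟨ σ ⟩) × t ≡ plug u (proj₂ lr ⟨ σ ⟩))
      ⊎ (t ≡ plug u (proj₁ lr ⟨ σ ⟩) × s ≡ plug u (proj₂ lr ⟨ σ ⟩))

  _⇔*[_]_ : Ground → TES → Ground → Set
  s ⇔*[ S ] t = Star (TStep S) s t

  GEqn : Set
  GEqn = Ground × Ground

  GES : Set₁
  GES = GEqn → Set

  GStep : GES → Ground → Ground → Set
  GStep E s t = Σ GEqn λ lr → E lr × Σ (Ctx ⊥) λ u →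
      (s ≡ plug u (proj₁ lr) × t ≡ plug u (proj₂ lr))
      ⊎ (t ≡ plug u (proj₁ lr) × s ≡ plug u (proj₂ lr))

  _⇔*ᴱ[_]_ : Ground → GES → Ground → Set
  s ⇔*ᴱ[ E ] t = Star (GStep E) s t

  SameGES : GES → GES → Set
  SameGES E F = ∀ e → (E e → F e) × (F e → E e)

  -- A state [t]_Θ is represented by any representative t ∈ T; terms over
  -- Σ ∪ A are  Tm Ground  (a leaf  var t  is the state constant [t]_Θ).

  module _ (p q : Ground) (E : GES) where

    InT : Ground → Set
    InT s = Sub s p ⊎ Sub s q ⊎ (Σ GEqn λ e → E e × (Sub s (proj₁ e) ⊎ Sub s (proj₂ e)))

    Θ : Ground → Ground → Set
    Θ s t = InT s × InT t × (s ⇔*ᴱ[ E ] t)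

    -- the rules R:  f([t_1],…,[t_m]) → [f(t_1,…,t_m)]  for f(t_1,…,t_m) ∈ T
    -- (a rule with states given by representatives s_i of [t_i], s of [f(t_1..t_m)])
    Rule : Tm Ground → Tm Ground → Set
    Rule lhs rhs = Σ (Fin (Signature.nsym Sig)) λ f →
      Σ (Vec Ground (rank f)) λ ts → Σ (Vec Ground (rank f)) λ ss → Σ Ground λ s →
        InT (node f ts) × (∀ i → Θ (lookup ts i) (lookup ss i)) × Θ (node f ts) s ×
        lhs ≡ node f (Vec.map var ss) × rhs ≡ var s

    RStep : Tm Ground → Tm Ground → Set
    RStep t t′ = Σ (Ctx Ground) λ u → Σ (Tm Ground) λ l → Σ (Tm Ground) λ r →
      Rule l r × t ≡ plug u l × t′ ≡ plug u r

    ReachesState : Tm Ground → Ground → Set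
    ReachesState t a = Σ Ground λ a′ → Θ a′ a × Star RStep t (var a′)

    ReachesFrom : Ground → Ground → Set
    ReachesFrom c b = Σ (Ctx ⊥) λ u → ReachesState (plug (liftCtx u) (var c)) b

  -- tree(a): a fixed deterministic choice, for each GTES E (and the fixed
  -- p, q), of a ground term tree(a) with tree(a) →*_R a, for every state a.
  -- It must depend on the state only (not on the chosen representative).

  TreeChoice : Set₁
  TreeChoice = GES → Ground → Ground

  ValidTreeFor : Ground → Ground → TreeChoice → GES → Set
  ValidTreeFor p q tree E =
    (∀ (t : Ground) → InT p q E t → ReachesState p q E (embed (tree E t)) t)
    × (∀ (t t′ : Ground) → Θ p q E t t′ → tree E t ≡ tree E t′)

  -- The sequences W_i, P_i, Q_i.  Tgt selects the target terms:
  -- {p, q} for W, {p} for P, {q} for Q.  Indexing is 0-based: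
  -- Seq … k  is the (k+1)-st set (so  Seq … 0  is W_1 / P_1 / Q_1).

  module _ (S : TES) (p q : Ground) (tree : TreeChoice) where

    First : (Ground → Set) → GES
    First Tgt (s , t) = Σ (OpenTerm × OpenTerm) λ lr → lr ∈ S × Σ (ℕ → Ground) λ σ →
      s ≡ (proj₁ lr ⟨ σ ⟩) × t ≡ (proj₂ lr ⟨ σ ⟩) ×
      (Σ Ground λ g → Tgt g × (Sub (proj₁ lr ⟨ σ ⟩) g ⊎ Sub (proj₂ lr ⟨ σ ⟩) g))

    Next : (Ground → Set) → GES → GES
    Next Tgt E (s , t) = Σ (OpenTerm × OpenTerm) λ lr → lr ∈ S ×
      Σ (ℕ → Ground) λ τ → (∀ x → InT p q E (τ x)) ×
      Σ Ground λ a → InT p q E a ×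
        (ReachesState p q E (proj₁ lr ⟨ (λ x → var (τ x)) ⟩) a
          ⊎ ReachesState p q E (proj₂ lr ⟨ (λ x → var (τ x)) ⟩) a) ×   -- (1)
        (Σ Ground λ g → Tgt g × ReachesFrom p q E a g) ×                -- (2)
        ¬ (s ⇔*ᴱ[ E ] t) ×                                              -- (3)
        s ≡ (proj₁ lr ⟨ (λ x → tree E (τ x)) ⟩) ×
        t ≡ (proj₂ lr ⟨ (λ x → tree E (τ x)) ⟩)

    Seq : (Ground → Set) → ℕ → GES
    Seq Tgt zero = First Tgt
    Seq Tgt (suc k) e = Seq Tgt k e ⊎ Next Tgt (Seq Tgt k) e

    Wseq Pseq Qseq : ℕ → GES
    Wseq = Seq (λ g → g ≡ p ⊎ g ≡ q)
    Pseq = Seq (λ g → g ≡ p)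
    Qseq = Seq (λ g → g ≡ q)

    TreeOK : Set
    TreeOK = ∀ k → ValidTreeFor p q tree (Wseq k)
                 × ValidTreeFor p q tree (Pseq k)
                 × ValidTreeFor p q tree (Qseq k)

    YesTest : ℕ → Set
    YesTest k = p ⇔*ᴱ[ Wseq k ] q

    NoTest : ℕ → Set
    NoTest zero = ⊥
    NoTest (suc k) = SameGES (Wseq (suc k)) (Wseq k)
                   ⊎ SameGES (Pseq (suc k)) (Pseq k)
                   ⊎ SameGES (Qseq (suc k)) (Qseq k)

    Continues : ℕ → Set
    Continues k = ¬ YesTest k × ¬ NoTest k

    OutputsYes : Set
    OutputsYes = Σ ℕ λ k → (∀ j → j < k → Continues j) × YesTest k

    OutputsNo : Set
    OutputsNo = Σ ℕ λ k → (∀ j → j < k → Continues j) × ¬ YesTest k × NoTest k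

module Submission where

-- 'yes': every equation of every W_i is a ground instance of an equation of
-- S (seq-instance), so p ⇔*_{W_i} q implies p ⇔*_S q.
--
-- The key lemma (Closure.instance-closes) says that an instance of an equation
-- of S whose side is accepted in a state leading to a target holds modulo
-- X ∪ Next X.  Hence if X_k (one of W_k, P_k, Q_k) is unchanged, the
-- ⇔*_{X_k}-class of p (resp. q) is closed under ⇔_S (Stability), and by
-- induction on k every equation of P_k or Q_k holds modulo W_k (Inclusion).
-- Either way p ⇔*_S q would give p ⇔*_{W_k} q, contradicting the failed
-- 'yes' test.  Condition (3) of the procedure is a negation, so these
-- lemmas live in the double negation monad, which suffices because the
-- 'no' conclusion is itself a negation.

open import Defs
open import Data.Nat using (ℕ; zero; suc)
import Data.Nat as ℕ
open import Data.Fin using (Fin; zero; suc)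
import Data.Fin.Properties as Fin
open import Data.Vec using (Vec; []; _∷_; lookup; _[_]≔_)
import Data.Vec as Vec
import Data.Vec.Properties as Vec
open import Data.Empty using (⊥; ⊥-elim)
open import Data.Product using (Σ; _×_; _,_; proj₁; proj₂)
open import Data.Sum using (_⊎_; inj₁; inj₂)
open import Data.List.Membership.Propositional using (_∈_)
open import Level using (0ℓ)
open import Relation.Nullary using (¬_; Dec; yes; no)
open import Relation.Nullary.Negation using (¬¬-Monad)
open import Effect.Monad using (RawMonad)
open import Relation.Binary.PropositionalEquality
  using (_≡_; refl; sym; trans; cong; cong₂; subst; subst₂; module ≡-Reasoning)
open import Function using (_∘_)
open import Relation.Binary.Construct.Closure.ReflexiveTransitive as Star
  using (Star; ε; _◅_; _◅◅_; gmap)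

star-pointwise : ∀ {A B : Set} {R : A → A → Set} {R′ : B → B → Set} {n}
  (build : Vec A n → B) →
  (∀ vs i {a b} → Star R a b → Star R′ (build (vs [ i ]≔ a)) (build (vs [ i ]≔ b))) →
  ∀ ts us → (∀ i → Star R (lookup ts i) (lookup us i)) → Star R′ (build ts) (build us)
star-pointwise build at [] [] eqs = ε
star-pointwise build at (t ∷ ts) (u ∷ us) eqs =
  at (t ∷ ts) zero (eqs zero) ◅◅
  star-pointwise (λ vs → build (u ∷ vs)) (λ vs i → at (u ∷ vs) (suc i)) ts us (eqs ∘ suc)

module Theory (Sig : Signature) where
  open Signature Sig
  open RawMonad (¬¬-Monad {a = 0ℓ}) using (pure; _>>=_)

  Term : Set → Set
  Term = Tm Sig

  G : Set
  G = Ground Sig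

  infixl 50 _⟪_⟫
  _⟪_⟫ : ∀ {V W : Set} → Term V → (V → Term W) → Term W
  _⟪_⟫ = _⟨_⟩ Sig

  _⟪_⟫* : ∀ {V W : Set} {n} → Vec (Term V) n → (V → Term W) → Vec (Term W) n
  _⟪_⟫* = substs Sig

  fill : ∀ {V : Set} → Ctx Sig V → Term V → Term V
  fill = plug Sig

  emb : ∀ {V : Set} → G → Term V
  emb = embed Sig

  mutual
    subst-cong : ∀ {V W : Set} (t : Term V) {σ ρ : V → Term W} →
      (∀ x → Occurs Sig x t → σ x ≡ ρ x) → t ⟪ σ ⟫ ≡ t ⟪ ρ ⟫
    subst-cong (var x) h = h x here
    subst-cong (node f ts) h = cong (node f) (substs-cong ts (λ i x o → h x (there i o)))

    substs-cong : ∀ {V W : Set} {n} (ts : Vec (Term V) n) {σ ρ : V → Term W} →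
      (∀ i x → Occurs Sig x (lookup ts i) → σ x ≡ ρ x) → ts ⟪ σ ⟫* ≡ ts ⟪ ρ ⟫*
    substs-cong [] h = refl
    substs-cong (t ∷ ts) h = cong₂ _∷_ (subst-cong t (h zero)) (substs-cong ts (λ i → h (suc i)))

  mutual
    subst-∘ : ∀ {U V W : Set} (t : Term U) (σ : U → Term V) (ρ : V → Term W) →
      t ⟪ σ ⟫ ⟪ ρ ⟫ ≡ t ⟪ (λ x → σ x ⟪ ρ ⟫) ⟫
    subst-∘ (var x) σ ρ = refl
    subst-∘ (node f ts) σ ρ = cong (node f) (substs-∘ ts σ ρ)

    substs-∘ : ∀ {U V W : Set} {n} (ts : Vec (Term U) n) (σ : U → Term V) (ρ : V → Term W) →
      ts ⟪ σ ⟫* ⟪ ρ ⟫* ≡ ts ⟪ (λ x → σ x ⟪ ρ ⟫) ⟫*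
    substs-∘ [] σ ρ = refl
    substs-∘ (t ∷ ts) σ ρ = cong₂ _∷_ (subst-∘ t σ ρ) (substs-∘ ts σ ρ)

  mutual
    subst-var : ∀ {V : Set} (t : Term V) → t ⟪ var ⟫ ≡ t
    subst-var (var x) = refl
    subst-var (node f ts) = cong (node f) (substs-var ts)

    substs-var : ∀ {V : Set} {n} (ts : Vec (Term V) n) → ts ⟪ var ⟫* ≡ ts
    substs-var [] = refl
    substs-var (t ∷ ts) = cong₂ _∷_ (subst-var t) (substs-var ts)

  substs-map : ∀ {V W : Set} {n} (ts : Vec (Term V) n) (σ : V → Term W) →
    ts ⟪ σ ⟫* ≡ Vec.map (_⟪ σ ⟫) ts
  substs-map [] σ = refl
  substs-map (t ∷ ts) σ = cong (t ⟪ σ ⟫ ∷_) (substs-map ts σ)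

  lookup-substs : ∀ {V W : Set} {n} (ts : Vec (Term V) n) (σ : V → Term W) i →
    lookup (ts ⟪ σ ⟫*) i ≡ lookup ts i ⟪ σ ⟫
  lookup-substs ts σ i = trans (cong (λ us → lookup us i) (substs-map ts σ)) (Vec.lookup-map i _ ts)

  substs-update : ∀ {V W : Set} {n} (ts : Vec (Term V) n) i t (σ : V → Term W) →
    (ts [ i ]≔ t) ⟪ σ ⟫* ≡ (ts ⟪ σ ⟫*) [ i ]≔ (t ⟪ σ ⟫)
  substs-update (_ ∷ ts) zero t σ = refl
  substs-update (u ∷ ts) (suc i) t σ = cong (u ⟪ σ ⟫ ∷_) (substs-update ts i t σ)

  ground-fixed : ∀ (g : G) {σ : ⊥ → G} → g ⟪ σ ⟫ ≡ g
  ground-fixed g = trans (subst-cong g (λ ())) (subst-var g)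

  eval : Term G → G
  eval t = t ⟪ (λ g → g) ⟫

  eval-emb : ∀ (g : G) → eval (emb g) ≡ g
  eval-emb g = trans (subst-∘ g (λ ()) (λ g → g)) (ground-fixed g)

  _∘ᶜ_ : ∀ {V : Set} → Ctx Sig V → Ctx Sig V → Ctx Sig V
  hole ∘ᶜ u = u
  node f i ts c ∘ᶜ u = node f i ts (c ∘ᶜ u)

  fill-∘ᶜ : ∀ {V : Set} (c u : Ctx Sig V) t → fill (c ∘ᶜ u) t ≡ fill c (fill u t)
  fill-∘ᶜ hole u t = refl
  fill-∘ᶜ (node f i ts c) u t = cong (λ z → node f (ts [ i ]≔ z)) (fill-∘ᶜ c u t)

  _⟪_⟫ᶜ : ∀ {V W : Set} → Ctx Sig V → (V → Term W) → Ctx Sig W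
  hole ⟪ σ ⟫ᶜ = hole
  node f i ts c ⟪ σ ⟫ᶜ = node f i (ts ⟪ σ ⟫*) (c ⟪ σ ⟫ᶜ)

  fill-subst : ∀ {V W : Set} (c : Ctx Sig V) t (σ : V → Term W) →
    fill c t ⟪ σ ⟫ ≡ fill (c ⟪ σ ⟫ᶜ) (t ⟪ σ ⟫)
  fill-subst hole t σ = refl
  fill-subst (node f i ts c) t σ =
    cong (node f) (trans (substs-update ts i _ σ) (cong (ts ⟪ σ ⟫* [ i ]≔_) (fill-subst c t σ)))

  eval-lift : ∀ (u : Ctx Sig ⊥) (t : Term G) → eval (fill (liftCtx Sig u) t) ≡ fill u (eval t)
  eval-lift hole t = refl
  eval-lift (node f i ts u) t = cong (node f)
    (trans (substs-update (Vec.map emb ts) i _ (λ g → g))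
      (cong₂ _[ i ]≔_ evalTs (eval-lift u t)))
    where
      evalTs : Vec.map emb ts ⟪ (λ g → g) ⟫* ≡ ts
      evalTs = begin
        Vec.map emb ts ⟪ (λ g → g) ⟫*   ≡⟨ substs-map _ _ ⟩
        Vec.map eval (Vec.map emb ts)  ≡⟨ Vec.map-∘ eval emb ts ⟨
        Vec.map (eval ∘ emb) ts        ≡⟨ Vec.map-cong eval-emb ts ⟩
        Vec.map (λ g → g) ts           ≡⟨ Vec.map-id ts ⟩
        ts                             ∎
        where open ≡-Reasoning

  emb-fill : ∀ (u : Ctx Sig ⊥) (g : G) → emb {G} (fill u g) ≡ fill (liftCtx Sig u) (emb g)
  emb-fill hole g = refl
  emb-fill (node f i ts u) g = cong (node f)
    (trans (substs-update ts i _ (λ ())) (cong₂ _[ i ]≔_ (substs-map ts (λ ())) (emb-fill u g)))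

  sub-trans : ∀ {V : Set} {s t u : Term V} → Sub Sig s t → Sub Sig t u → Sub Sig s u
  sub-trans s⊑t here = s⊑t
  sub-trans s⊑t (there i t⊑u) = there i (sub-trans s⊑t t⊑u)

  mutual
    occurs? : ∀ (x : ℕ) (t : Term ℕ) → Dec (Occurs Sig x t)
    occurs? x (var y) with x ℕ.≟ y
    ... | yes refl = yes here
    ... | no x≢y = no λ { here → x≢y refl }
    occurs? x (node f ts) with occursIn? x ts
    ... | yes (i , o) = yes (there i o)
    ... | no ¬o = no λ { (there i o) → ¬o (i , o) }

    occursIn? : ∀ (x : ℕ) {n} (ts : Vec (Term ℕ) n) → Dec (Σ (Fin n) λ i → Occurs Sig x (lookup ts i))
    occursIn? x [] = no λ { (() , _) }
    occursIn? x (t ∷ ts) with occurs? x t | occursIn? x ts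
    ... | yes o | _ = yes (zero , o)
    ... | no _ | yes (i , o) = yes (suc i , o)
    ... | no ¬o | no ¬os = no λ { (zero , o) → ¬o o ; (suc i , o) → ¬os (i , o) }

  module Equational (E : GES Sig) where
    Step : G → G → Set
    Step = GStep Sig E

    infix 4 _≈_
    _≈_ : G → G → Set
    _≈_ = Star Step

    step-sym : ∀ {g h} → Step g h → Step h g
    step-sym (e , e∈E , u , inj₁ eqs) = e , e∈E , u , inj₂ eqs
    step-sym (e , e∈E , u , inj₂ eqs) = e , e∈E , u , inj₁ eqs

    ≈-sym : ∀ {g h} → g ≈ h → h ≈ g
    ≈-sym = Star.reverse step-sym

    ≈-axiom : ∀ {s t} → E (s , t) → s ≈ t
    ≈-axiom e∈E = (_ , e∈E , hole , inj₁ (refl , refl)) ◅ ε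

    ≈-fill : ∀ (c : Ctx Sig ⊥) {g h} → g ≈ h → fill c g ≈ fill c h
    ≈-fill c = gmap (fill c) stepFill
      where
        stepFill : ∀ {g h} → Step g h → Step (fill c g) (fill c h)
        stepFill (e , e∈E , u , inj₁ (refl , refl)) =
          e , e∈E , c ∘ᶜ u , inj₁ (sym (fill-∘ᶜ c u _) , sym (fill-∘ᶜ c u _))
        stepFill (e , e∈E , u , inj₂ (refl , refl)) =
          e , e∈E , c ∘ᶜ u , inj₂ (sym (fill-∘ᶜ c u _) , sym (fill-∘ᶜ c u _))

    ≈-cong : ∀ f (ts us : Vec G (rank f)) → (∀ i → lookup ts i ≈ lookup us i) → node f ts ≈ node f us
    ≈-cong f = star-pointwise (node f) (λ vs i → ≈-fill (node f i vs hole))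

    mutual
      ≈-subst : ∀ (t : Term ℕ) {σ ρ : ℕ → G} → (∀ x → Occurs Sig x t → σ x ≈ ρ x) → t ⟪ σ ⟫ ≈ t ⟪ ρ ⟫
      ≈-subst (var x) h = h x here
      ≈-subst (node f ts) {σ} {ρ} h = ≈-cong f (ts ⟪ σ ⟫*) (ts ⟪ ρ ⟫*) (≈-substs ts (λ i x o → h x (there i o)))

      ≈-substs : ∀ {n} (ts : Vec (Term ℕ) n) {σ ρ : ℕ → G} →
        (∀ i x → Occurs Sig x (lookup ts i) → σ x ≈ ρ x) → ∀ i → lookup (ts ⟪ σ ⟫*) i ≈ lookup (ts ⟪ ρ ⟫*) i
      ≈-substs (t ∷ ts) h zero = ≈-subst t (h zero)
      ≈-substs (t ∷ ts) h (suc i) = ≈-substs ts (h ∘ suc) i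

  ≈-mono : ∀ {E F : GES Sig} → (∀ e → E e → F e) → ∀ {g h} → Equational._≈_ E g h → Equational._≈_ F g h
  ≈-mono E⊆F = Star.map λ { (e , e∈E , u , eqs) → e , E⊆F e e∈E , u , eqs }

  -- Rather than reasoning about rewrite sequences with R directly, we use
  -- runs: a run records, bottom-up, the state reached at every node.

  module Automaton (p q : G) (E : GES Sig) where
    open Equational E

    InTerms : G → Set
    InTerms = InT Sig p q E

    infix 4 _∼_
    _∼_ : G → G → Set
    _∼_ = Θ Sig p q E

    ∼-refl : ∀ {a} → InTerms a → a ∼ a
    ∼-refl a∈T = a∈T , a∈T , ε

    ∼-sym : ∀ {a b} → a ∼ b → b ∼ a
    ∼-sym (a∈T , b∈T , a≈b) = b∈T , a∈T , ≈-sym a≈b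

    ∼-trans : ∀ {a b c} → a ∼ b → b ∼ c → a ∼ c
    ∼-trans (a∈T , _ , a≈b) (_ , c∈T , b≈c) = a∈T , c∈T , a≈b ◅◅ b≈c

    inTerms-sub : ∀ {s t} → InTerms t → Sub Sig s t → InTerms s
    inTerms-sub (inj₁ t⊑p) s⊑t = inj₁ (sub-trans s⊑t t⊑p)
    inTerms-sub (inj₂ (inj₁ t⊑q)) s⊑t = inj₂ (inj₁ (sub-trans s⊑t t⊑q))
    inTerms-sub (inj₂ (inj₂ (e , e∈E , inj₁ t⊑l))) s⊑t = inj₂ (inj₂ (e , e∈E , inj₁ (sub-trans s⊑t t⊑l)))
    inTerms-sub (inj₂ (inj₂ (e , e∈E , inj₂ t⊑r))) s⊑t = inj₂ (inj₂ (e , e∈E , inj₂ (sub-trans s⊑t t⊑r)))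

    lhs∈T : ∀ {l r} → E (l , r) → InTerms l
    lhs∈T e∈E = inj₂ (inj₂ (_ , e∈E , inj₁ here))

    rhs∈T : ∀ {l r} → E (l , r) → InTerms r
    rhs∈T e∈E = inj₂ (inj₂ (_ , e∈E , inj₂ here))

    -- A node is processed by the rule
    -- f([s_1],…,[s_m]) → [f(s_1,…,s_m)], which exists when f(s_1,…,s_m) ∈ T.
    data Run {V : Set} (L : V → G → Set) : Term V → G → Set where
      leaf : ∀ {x b s} → L x b → b ∼ s → Run L (var x) s
      node : ∀ {f ts s} (ss : Vec G (rank f)) → InTerms (node f ss) →
             (∀ i → Run L (lookup ts i) (lookup ss i)) → node f ss ∼ s → Run L (node f ts) s

    -- Runs on ground terms: g is accepted in state [s], i.e. g →*_R [s].
    Accepts : G → G → Set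
    Accepts = Run (λ ())

    Accepted : G → Set
    Accepted g = Σ G (Accepts g)

    run-target : ∀ {V L} {t : Term V} {s} → Run L t s → InTerms s
    run-target (leaf _ b∼s) = proj₁ (proj₂ b∼s)
    run-target (node _ _ _ n∼s) = proj₁ (proj₂ n∼s)

    run-retarget : ∀ {V L} {t : Term V} {s s′} → Run L t s → s ∼ s′ → Run L t s′
    run-retarget (leaf l b∼s) s∼s′ = leaf l (∼-trans b∼s s∼s′)
    run-retarget (node ss n∈T runs n∼s) s∼s′ = node ss n∈T runs (∼-trans n∼s s∼s′)

    relabel : ∀ {V} {L L′ : V → G → Set} {t : Term V} {s} →
      (∀ x b → Occurs Sig x t → L x b → L′ x b) → Run L t s → Run L′ t s
    relabel k (leaf l b∼s) = leaf (k _ _ here l) b∼s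
    relabel k (node ss n∈T runs n∼s) = node ss n∈T (λ i → relabel (λ x b o → k x b (there i o)) (runs i)) n∼s

    leaf-label : ∀ {V} {L : V → G → Set} {t : Term V} {s x} → Run L t s → Occurs Sig x t → Σ G (L x)
    leaf-label (leaf l _) here = _ , l
    leaf-label (node _ _ runs _) (there i o) = leaf-label (runs i) o

    run-sound : ∀ {V} {L : V → G → Set} (ρ : V → G) → (∀ x b → L x b → ρ x ≈ b) →
      ∀ {t s} → Run L t s → t ⟪ ρ ⟫ ≈ s
    run-sound ρ k (leaf l b∼s) = k _ _ l ◅◅ proj₂ (proj₂ b∼s)
    run-sound ρ k (node {f} {ts} ss _ runs n∼s) =
      ≈-cong f (ts ⟪ ρ ⟫*) ss (λ i → subst (_≈ lookup ss i) (sym (lookup-substs ts ρ i)) (run-sound ρ k (runs i)))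
      ◅◅ proj₂ (proj₂ n∼s)

    accepts-sound : ∀ {g s} → Accepts g s → g ≈ s
    accepts-sound {g} acc = subst (_≈ _) (ground-fixed g) (run-sound (λ ()) (λ ()) acc)

    mutual
      accepts-complete : ∀ g → InTerms g → Accepts g g
      accepts-complete (node f ts) g∈T =
        node ts g∈T (accepts-completes ts (λ i → inTerms-sub g∈T (there i here))) (∼-refl g∈T)

      accepts-completes : ∀ {n} (ts : Vec G n) → (∀ i → InTerms (lookup ts i)) → ∀ i → Accepts (lookup ts i) (lookup ts i)
      accepts-completes (t ∷ ts) ts∈T zero = accepts-complete t (ts∈T zero)
      accepts-completes (t ∷ ts) ts∈T (suc i) = accepts-completes ts (ts∈T ∘ suc) i

    accepts-det : ∀ {g s s′} → Accepts g s → Accepts g s′ → s ∼ s′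
    accepts-det (node {f} ss n∈T runs n∼s) (node ss′ n′∈T runs′ n′∼s′) =
      ∼-trans (∼-sym n∼s)
        (∼-trans (n∈T , n′∈T , ≈-cong f ss ss′ (λ i → proj₂ (proj₂ (accepts-det (runs i) (runs′ i))))) n′∼s′)

    run-split : ∀ {V W : Set} {L : W → G → Set} {σ : V → Term W} {u s} → Run L u s →
      ∀ (t : Term V) → u ≡ t ⟪ σ ⟫ → Run (λ x b → Run L (σ x) b) t s
    run-split run (var x) refl = leaf run (∼-refl (run-target run))
    run-split {σ = σ} (node ss n∈T runs n∼s) (node f ts) refl =
      node ss n∈T (λ i → run-split (runs i) (lookup ts i) (lookup-substs ts σ i)) n∼s

    run-join : ∀ {V W : Set} {L : W → G → Set} {σ : V → Term W} {t s} →
      Run (λ x b → Run L (σ x) b) t s → Run L (t ⟪ σ ⟫) s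
    run-join (leaf run b∼s) = run-retarget run b∼s
    run-join {σ = σ} (node {f} {ts} ss n∈T runs n∼s) =
      node ss n∈T (λ i → subst (λ z → Run _ z (lookup ss i)) (sym (lookup-substs ts σ i)) (run-join (runs i))) n∼s

    run-ctx : ∀ {V} {L : V → G → Set} (u : Ctx Sig V) {t s} → Run L (fill u t) s →
      Σ G λ c → Run L t c × (∀ t′ → Run L t′ c → Run L (fill u t′) s)
    run-ctx hole run = _ , run , λ t′ run′ → run′
    run-ctx {L = L} (node f i ts u) {t} (node ss n∈T runs n∼s)
      with run-ctx u (subst (λ z → Run L z (lookup ss i)) (Vec.lookup∘update i ts (fill u t)) (runs i))
    ... | c , run-t , replace = c , run-t , λ t′ run′ → node ss n∈T (children t′ run′) n∼s
      where
        children : ∀ t′ → Run L t′ c → ∀ j → Run L (lookup (ts [ i ]≔ fill u t′) j) (lookup ss j)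
        children t′ run′ j with j Fin.≟ i
        ... | yes refl = subst (λ z → Run L z (lookup ss j)) (sym (Vec.lookup∘update i ts (fill u t′))) (replace t′ run′)
        ... | no j≢i = subst (λ z → Run L z (lookup ss j))
                (trans (Vec.lookup∘update′ j≢i ts _) (sym (Vec.lookup∘update′ j≢i ts _))) (runs j)

    -- Both sides of an equation of E are in T and in the same class, so the
    -- automaton accepts them in the same state; hence acceptance is
    -- invariant under ⇔*_E.
    accepts-swap : ∀ {l r s} → InTerms l → InTerms r → l ≈ r → Accepts l s → Accepts r s
    accepts-swap {l} {r} l∈T r∈T l≈r acc =
      run-retarget (accepts-complete r r∈T) (∼-trans (r∈T , l∈T , ≈-sym l≈r) (accepts-det (accepts-complete l l∈T) acc))

    accepts-step : ∀ {g h s} → Accepts g s → Step g h → Accepts h s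
    accepts-step acc ((l , r) , e∈E , u , inj₁ (refl , refl)) with run-ctx u acc
    ... | c , acc-l , replace = replace r (accepts-swap (lhs∈T e∈E) (rhs∈T e∈E) (≈-axiom e∈E) acc-l)
    accepts-step acc ((l , r) , e∈E , u , inj₂ (refl , refl)) with run-ctx u acc
    ... | c , acc-r , replace = replace l (accepts-swap (rhs∈T e∈E) (lhs∈T e∈E) (≈-sym (≈-axiom e∈E)) acc-r)

    accepts-≈ : ∀ {g h s} → Accepts g s → g ≈ h → Accepts h s
    accepts-≈ acc ε = acc
    accepts-≈ acc (st ◅ sts) = accepts-≈ (accepts-step acc st) sts

    accepted-sub : ∀ {s t b} → Sub Sig s t → Accepts t b → Accepted s
    accepted-sub here acc = _ , acc
    accepted-sub (there i s⊑t) (node _ _ runs _) = accepted-sub s⊑t (runs i)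

    RuleStep : Term G → Term G → Set
    RuleStep = RStep Sig p q E

    Reach : Term G → G → Set
    Reach = ReachesState Sig p q E

    rule-steps-fill : ∀ (c : Ctx Sig G) {t t′} → Star RuleStep t t′ → Star RuleStep (fill c t) (fill c t′)
    rule-steps-fill c = gmap (fill c) λ { (u , l , r , rule , refl , refl) →
      c ∘ᶜ u , l , r , rule , sym (fill-∘ᶜ c u l) , sym (fill-∘ᶜ c u r) }

    reach-of-run : ∀ {t s} → Run _≡_ t s → Reach t s
    reach-of-run (leaf refl b∼s) = _ , b∼s , ε
    reach-of-run {s = s} (node {f} {ts} ss n∈T runs n∼s) =
      s , ∼-refl (proj₁ (proj₂ n∼s)) , args ◅◅ (rule ◅ ε)
      where
        reach : ∀ i → Reach (lookup ts i) (lookup ss i)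
        reach i = reach-of-run (runs i)
        reps : Vec G (rank f)
        reps = Vec.tabulate (λ i → proj₁ (reach i))
        lookup-reps : ∀ i → lookup reps i ≡ proj₁ (reach i)
        lookup-reps = Vec.lookup∘tabulate (λ i → proj₁ (reach i))
        args : Star RuleStep (node f ts) (node f (Vec.map var reps))
        args = star-pointwise (node f) (λ vs i → rule-steps-fill (node f i vs hole)) ts (Vec.map var reps)
          (λ i → subst (Star RuleStep (lookup ts i)) (sym (trans (Vec.lookup-map i var reps) (cong var (lookup-reps i))))
                   (proj₂ (proj₂ (reach i))))
        rule : RuleStep (node f (Vec.map var reps)) (var s)
        rule = hole , _ , _ ,
          (f , ss , reps , s , n∈T ,
            (λ i → subst (lookup ss i ∼_) (sym (lookup-reps i)) (∼-sym (proj₁ (proj₂ (reach i))))) ,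
            n∼s , refl , refl) , refl , refl

    rule-step-sound : ∀ {t t′} → RuleStep t t′ → eval t ≈ eval t′
    rule-step-sound (u , _ , _ , (f , ts , ss , s , _ , args∼ , n∼s , refl , refl) , refl , refl) =
      subst₂ _≈_ (sym (fill-subst u _ (λ g → g))) (sym (fill-subst u _ (λ g → g)))
        (≈-fill (u ⟪ (λ g → g) ⟫ᶜ)
          (subst (_≈ s) (sym (cong (node f) eval-reps))
            (≈-cong f ss ts (λ i → ≈-sym (proj₂ (proj₂ (args∼ i)))) ◅◅ proj₂ (proj₂ n∼s))))
      where
        eval-reps : Vec.map var ss ⟪ (λ g → g) ⟫* ≡ ss
        eval-reps = trans (substs-map _ _) (trans (sym (Vec.map-∘ eval var ss)) (Vec.map-id ss))

    reach-sound : ∀ {t a} → Reach t a → eval t ≈ a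
    reach-sound (a′ , a′∼a , steps) = Star.fold (λ t t′ → eval t ≈ eval t′) (λ st → rule-step-sound st ◅◅_) ε steps
                                     ◅◅ proj₂ (proj₂ a′∼a)

    accepts-emb : ∀ {g s} → Accepts g s → Run _≡_ (emb g) s
    accepts-emb acc = run-join (relabel (λ ()) acc)

    emb-accepts : ∀ {g s} → Run _≡_ (emb g) s → Accepts g s
    emb-accepts {g} run = relabel (λ ()) (run-split run g refl)

    reaches-from : ∀ (u : Ctx Sig ⊥) c {b} → InTerms c → Accepts (fill u c) b →
      Reach (fill (liftCtx Sig u) (var c)) b
    reaches-from u c c∈T acc
      with run-ctx (liftCtx Sig u) (subst (λ z → Run _≡_ z _) (emb-fill u c) (accepts-emb acc))
    ... | c′ , run-c , replace = reach-of-run (replace (var c) (leaf refl (accepts-det (accepts-complete c c∈T) (emb-accepts run-c))))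

    choose-states : ∀ (t : Term ℕ) (σ : ℕ → G) {c} (d : G) → InTerms d →
      Run (λ x b → Accepts (σ x) b) t c →
      Σ (ℕ → G) λ τ → (∀ x → InTerms (τ x)) × (∀ x → Occurs Sig x t → Accepts (σ x) (τ x)) ×
        Reach (t ⟪ (λ x → var (τ x)) ⟫) c
    choose-states t σ d d∈T run = τ , τ∈T , accepts-τ , reach-of-run (run-join (relabel label run))
      where
        τ : ℕ → G
        τ x with occurs? x t
        ... | yes o = proj₁ (leaf-label run o)
        ... | no _ = d
        accepts-τ : ∀ x → Occurs Sig x t → Accepts (σ x) (τ x)
        accepts-τ x o with occurs? x t
        ... | yes o′ = proj₂ (leaf-label run o′)
        ... | no ¬o = ⊥-elim (¬o o)
        τ∈T : ∀ x → InTerms (τ x)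
        τ∈T x with occurs? x t
        ... | yes o = run-target (proj₂ (leaf-label run o))
        ... | no _ = d∈T
        label : ∀ x b → Occurs Sig x t → Accepts (σ x) b → Run _≡_ (var (τ x)) b
        label x b o acc = leaf refl (accepts-det (accepts-τ x o) acc)

    reach-subst-sound : ∀ (t : Term ℕ) (τ : ℕ → G) {c} → Reach (t ⟪ (λ x → var (τ x)) ⟫) c → t ⟪ τ ⟫ ≈ c
    reach-subst-sound t τ reach = subst (_≈ _) (subst-∘ t (λ x → var (τ x)) (λ g → g)) (reach-sound reach)

    reaches-from-sound : ∀ (u : Ctx Sig ⊥) {c b} → Reach (fill (liftCtx Sig u) (var c)) b → fill u c ≈ b
    reaches-from-sound u reach = subst (_≈ _) (eval-lift u (var _)) (reach-sound reach)

  module _ {p q : G} {E F : GES Sig} (E⊆F : ∀ e → E e → F e) where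
    private
      module A = Automaton p q E
      module B = Automaton p q F

    inTerms-mono : ∀ {g} → A.InTerms g → B.InTerms g
    inTerms-mono (inj₁ g⊑p) = inj₁ g⊑p
    inTerms-mono (inj₂ (inj₁ g⊑q)) = inj₂ (inj₁ g⊑q)
    inTerms-mono (inj₂ (inj₂ (e , e∈E , g⊑e))) = inj₂ (inj₂ (e , E⊆F e e∈E , g⊑e))

    ∼-mono : ∀ {a b} → a A.∼ b → a B.∼ b
    ∼-mono (a∈T , b∈T , a≈b) = inTerms-mono a∈T , inTerms-mono b∈T , ≈-mono E⊆F a≈b

    run-mono : ∀ {V} {L : V → G → Set} {t s} → A.Run L t s → B.Run L t s
    run-mono (A.leaf l b∼s) = B.leaf l (∼-mono b∼s)
    run-mono (A.node ss n∈T runs n∼s) = B.node ss (inTerms-mono n∈T) (λ i → run-mono (runs i)) (∼-mono n∼s)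

  tree-sound : ∀ {p q} (tree : TreeChoice Sig) {E : GES Sig} → ValidTreeFor Sig p q tree E →
    ∀ {t} → InT Sig p q E t → Equational._≈_ E (tree E t) t
  tree-sound {p} {q} tree {E} valid {t} t∈T =
    subst (λ z → Equational._≈_ E z t) (eval-emb (tree E t)) (Automaton.reach-sound p q E (proj₁ valid t t∈T))

  module Procedure (S : TES Sig) (p q : G) (tree : TreeChoice Sig) where

    infix 4 _⇔S_
    _⇔S_ : G → G → Set
    g ⇔S h = _⇔*[_]_ Sig g S h

    Seq′ : (G → Set) → ℕ → GES Sig
    Seq′ = Seq Sig S p q tree

    Next′ : (G → Set) → GES Sig → GES Sig
    Next′ = Next Sig S p q tree

    seq-instance : ∀ Tgt k {s t} → Seq′ Tgt k (s , t) →
      Σ (Term ℕ × Term ℕ) λ lr → lr ∈ S × Σ (ℕ → G) λ σ → s ≡ proj₁ lr ⟪ σ ⟫ × t ≡ proj₂ lr ⟪ σ ⟫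
    seq-instance Tgt zero (lr , lr∈S , σ , s≡ , t≡ , _) = lr , lr∈S , σ , s≡ , t≡
    seq-instance Tgt (suc k) (inj₁ e∈Seq) = seq-instance Tgt k e∈Seq
    seq-instance Tgt (suc k) (inj₂ (lr , lr∈S , _ , _ , _ , _ , _ , _ , _ , s≡ , t≡)) = lr , lr∈S , _ , s≡ , t≡

    seq-sound : ∀ Tgt k {g h} → Equational._≈_ (Seq′ Tgt k) g h → g ⇔S h
    seq-sound Tgt k = Star.map λ where
      (e , e∈Seq , u , inj₁ (refl , refl)) → let (lr , lr∈S , σ , s≡ , t≡) = seq-instance Tgt k e∈Seq in
        lr , lr∈S , u , σ , inj₁ (cong (fill u) s≡ , cong (fill u) t≡)
      (e , e∈Seq , u , inj₂ (refl , refl)) → let (lr , lr∈S , σ , s≡ , t≡) = seq-instance Tgt k e∈Seq in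
        lr , lr∈S , u , σ , inj₂ (cong (fill u) s≡ , cong (fill u) t≡)

    ⇔S-sym : ∀ {g h} → g ⇔S h → h ⇔S g
    ⇔S-sym = Star.reverse λ where
      (lr , lr∈S , u , σ , inj₁ eqs) → lr , lr∈S , u , σ , inj₂ eqs
      (lr , lr∈S , u , σ , inj₂ eqs) → lr , lr∈S , u , σ , inj₁ eqs

    target∈T : ∀ {E g} → g ≡ p ⊎ g ≡ q → InT Sig p q E g
    target∈T (inj₁ refl) = inj₁ here
    target∈T (inj₂ refl) = inj₂ (inj₁ here)

    data Oriented : Term ℕ → Term ℕ → Set where
      forward  : ∀ {l r} → (l , r) ∈ S → Oriented l r
      backward : ∀ {l r} → (l , r) ∈ S → Oriented r l

    oriented-occurs : VariablePreserving Sig S → ∀ {a b} → Oriented a b → ∀ x → Occurs Sig x b → Occurs Sig x a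
    oriented-occurs vp (forward lr∈S) x = proj₂ (vp lr∈S x)
    oriented-occurs vp (backward lr∈S) x = proj₁ (vp lr∈S x)

    -- Y contains X and everything the procedure adds to X (for Y = X this
    -- says that X is closed under the procedure).
    module Closure {Tgt : G → Set} {X Y : GES Sig}
                   (X⊆Y : ∀ e → X e → Y e) (next⊆Y : ∀ e → Next′ Tgt X e → Y e)
                   (valid : ValidTreeFor Sig p q tree X) (vp : VariablePreserving Sig S) where
      open Automaton p q X
      open Equational X using (≈-sym)
      module Y = Equational Y

      tr : (ℕ → G) → ℕ → G
      tr τ x = tree X (τ x)

      -- An equation of S instantiated by the trees of states τ satisfying
      -- conditions (1) and (2) holds modulo Y: either it already holds modulo X,
      -- or condition (3) holds as well and the equation is added.
      next-closes : ∀ {a b} → Oriented a b → (τ : ℕ → G) → (∀ x → InTerms (τ x)) → ∀ c → InTerms c →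
        Reach (a ⟪ (λ x → var (τ x)) ⟫) c → (Σ G λ g → Tgt g × ReachesFrom Sig p q X c g) →
        ¬ ¬ (a ⟪ tr τ ⟫ Y.≈ b ⟪ tr τ ⟫)
      next-closes (forward lr∈S) τ τ∈T c c∈T reach target ¬eq =
        ¬eq (Y.≈-axiom (next⊆Y _ (_ , lr∈S , τ , τ∈T , c , c∈T , inj₁ reach , target ,
          (λ eq → ¬eq (≈-mono X⊆Y eq)) , refl , refl)))
      next-closes (backward lr∈S) τ τ∈T c c∈T reach target ¬eq =
        ¬eq (Y.≈-sym (Y.≈-axiom (next⊆Y _ (_ , lr∈S , τ , τ∈T , c , c∈T , inj₂ reach , target ,
          (λ eq → ¬eq (Y.≈-sym (≈-mono X⊆Y eq))) , refl , refl))))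

      -- The states of the σ x give an instance over
      -- trees to which next-closes applies, and σ x ⇔*_X tree(τ x).
      instance-closes : ∀ {a b} → Oriented a b → (σ : ℕ → G) → ∀ {c} → Accepts (a ⟪ σ ⟫) c →
        (Σ G λ g → Tgt g × ReachesFrom Sig p q X c g) → ¬ ¬ (a ⟪ σ ⟫ Y.≈ b ⟪ σ ⟫)
      instance-closes {a} {b} ab σ {c} acc target
        with choose-states a σ c (run-target acc) (run-split acc a refl)
      ... | τ , τ∈T , acc-τ , reach = do
          eq ← next-closes ab τ τ∈T c (run-target acc) reach target
          pure (Y.≈-subst a σ≈tr ◅◅ eq ◅◅ Y.≈-sym (Y.≈-subst b (λ x o → σ≈tr x (oriented-occurs vp ab x o))))
        where
          σ≈tr : ∀ x → Occurs Sig x a → σ x Y.≈ tr τ x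
          σ≈tr x o = ≈-mono X⊆Y (accepts-sound (acc-τ x o) ◅◅ ≈-sym (tree-sound tree valid (τ∈T x)))

    module Stability {Tgt : G → Set} (k : ℕ)
                     (valid : ValidTreeFor Sig p q tree (Seq′ Tgt k))
                     (closed : ∀ e → Next′ Tgt (Seq′ Tgt k) e → Seq′ Tgt k e)
                     (vp : VariablePreserving Sig S)
                     {g₀ : G} (g₀∈Tgt : Tgt g₀) (g₀-target : g₀ ≡ p ⊎ g₀ ≡ q) where
      open Automaton p q (Seq′ Tgt k)
      open Equational (Seq′ Tgt k)
      open Closure {Tgt} (λ e e∈X → e∈X) closed valid vp using (instance-closes)

      g₀∈T : InTerms g₀
      g₀∈T = target∈T g₀-target

      -- Rewriting a⟪σ⟫ to b⟪σ⟫ inside u keeps a term in the class of g₀: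
      -- u[a⟪σ⟫] is accepted in [g₀], so a⟪σ⟫ is accepted in a state c from
      -- which the automaton reaches g₀.
      class-closed : ∀ {a b} → Oriented a b → ∀ u σ → fill u (a ⟪ σ ⟫) ≈ g₀ → ¬ ¬ (fill u (b ⟪ σ ⟫) ≈ g₀)
      class-closed ab u σ hyp with run-ctx u (accepts-≈ (accepts-complete g₀ g₀∈T) (≈-sym hyp))
      ... | c , acc , replace = do
          eq ← instance-closes ab σ acc (g₀ , g₀∈Tgt , u , reaches-from u c c∈T (replace c (accepts-complete c c∈T)))
          pure (≈-fill u (≈-sym eq) ◅◅ hyp)
        where
          c∈T : InTerms c
          c∈T = run-target acc

      stable-step : ∀ {t t′} → t ≈ g₀ → TStep Sig S t t′ → ¬ ¬ (t′ ≈ g₀)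
      stable-step hyp ((l , r) , lr∈S , u , σ , inj₁ (refl , refl)) = class-closed (forward lr∈S) u σ hyp
      stable-step hyp ((l , r) , lr∈S , u , σ , inj₂ (refl , refl)) = class-closed (backward lr∈S) u σ hyp

      stable : ∀ {t} → g₀ ⇔S t → ¬ ¬ (t ≈ g₀)
      stable = go ε
        where
          go : ∀ {t t′} → t ≈ g₀ → t ⇔S t′ → ¬ ¬ (t′ ≈ g₀)
          go hyp ε = pure hyp
          go hyp (st ◅ sts) = stable-step hyp st >>= λ hyp′ → go hyp′ sts

    module Inclusion {Tgt₁ Tgt₂ : G → Set} (Tgt₁⊆Tgt₂ : ∀ g → Tgt₁ g → Tgt₂ g)
                     (targets : ∀ g → Tgt₁ g → g ≡ p ⊎ g ≡ q)
                     (valid₁ : ∀ k → ValidTreeFor Sig p q tree (Seq′ Tgt₁ k))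
                     (valid₂ : ∀ k → ValidTreeFor Sig p q tree (Seq′ Tgt₂ k))
                     (vp : VariablePreserving Sig S) where

      Simulated : ℕ → Set
      Simulated k = ∀ {s t} → Seq′ Tgt₁ k (s , t) →
        ¬ ¬ (Equational._≈_ (Seq′ Tgt₂ k) s t × Automaton.Accepted p q (Seq′ Tgt₂ k) s
                                             × Automaton.Accepted p q (Seq′ Tgt₂ k) t)

      module Consequences (k : ℕ) (sim : Simulated k) where
        module EP = Equational (Seq′ Tgt₁ k)
        module EW = Equational (Seq′ Tgt₂ k)
        module AP = Automaton p q (Seq′ Tgt₁ k)
        module AW = Automaton p q (Seq′ Tgt₂ k)

        transfer : ∀ {g h} → g EP.≈ h → ¬ ¬ (g EW.≈ h)
        transfer ε = pure ε
        transfer ((_ , e∈P , u , inj₁ (refl , refl)) ◅ steps) = do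
          (eq , _) ← sim e∈P
          rest ← transfer steps
          pure (EW.≈-fill u eq ◅◅ rest)
        transfer ((_ , e∈P , u , inj₂ (refl , refl)) ◅ steps) = do
          (eq , _) ← sim e∈P
          rest ← transfer steps
          pure (EW.≈-fill u (EW.≈-sym eq) ◅◅ rest)

        accepted-of-T : ∀ {g} → AP.InTerms g → ¬ ¬ (AW.Accepted g)
        accepted-of-T {g} (inj₁ g⊑p) = pure (g , AW.accepts-complete g (inj₁ g⊑p))
        accepted-of-T {g} (inj₂ (inj₁ g⊑q)) = pure (g , AW.accepts-complete g (inj₂ (inj₁ g⊑q)))
        accepted-of-T (inj₂ (inj₂ (e , e∈P , inj₁ g⊑l))) = do
          (_ , (_ , acc-l) , _) ← sim e∈P
          pure (AW.accepted-sub g⊑l acc-l)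
        accepted-of-T (inj₂ (inj₂ (e , e∈P , inj₂ g⊑r))) = do
          (_ , _ , (_ , acc-r)) ← sim e∈P
          pure (AW.accepted-sub g⊑r acc-r)

        module EW′ = Equational (Seq′ Tgt₂ (suc k))
        module AW′ = Automaton p q (Seq′ Tgt₂ (suc k))

        W⊆W′ : ∀ e → Seq′ Tgt₂ k e → Seq′ Tgt₂ (suc k) e
        W⊆W′ e = inj₁

        open Closure {Tgt₂} W⊆W′ (λ e → inj₂) (valid₂ k) vp using (instance-closes)

        trP : (ℕ → G) → ℕ → G
        trP τ x = tree (Seq′ Tgt₁ k) (τ x)

        -- An equation added to Seq Tgt₁ k: its instance a⟪trP τ⟫ reaches the
        -- state c in the automaton of P = Seq Tgt₁ k, hence (transferring along
        -- the induction hypothesis) is accepted in the automaton of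
        -- W = Seq Tgt₂ k in a state c′ from which the same target is reached.
        -- The key lemma then puts it into Seq Tgt₂ (suc k).
        new-equation : ∀ {a b} → Oriented a b → (τ : ℕ → G) → (∀ x → AP.InTerms (τ x)) →
          ∀ c → AP.InTerms c → AP.Reach (a ⟪ (λ x → var (τ x)) ⟫) c →
          (Σ G λ g → Tgt₁ g × ReachesFrom Sig p q (Seq′ Tgt₁ k) c g) →
          ¬ ¬ (a ⟪ trP τ ⟫ EW′.≈ b ⟪ trP τ ⟫ × AW′.Accepted (a ⟪ trP τ ⟫) × AW′.Accepted (b ⟪ trP τ ⟫))
        new-equation {a} {b} ab τ τ∈T c c∈T reach (g , g∈Tgt , u , reach-g) = do
          a≈c ← transfer (EP.≈-subst a (λ x _ → tree-sound tree (valid₁ k) (τ∈T x)) ◅◅ AP.reach-subst-sound a τ reach)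
          (c′ , acc-c) ← accepted-of-T c∈T
          uc≈g ← transfer (AP.reaches-from-sound u reach-g)
          let acc-a = AW.accepts-≈ acc-c (EW.≈-sym a≈c)
              uc′≈g = EW.≈-fill u (EW.≈-sym (AW.accepts-sound acc-c)) ◅◅ uc≈g
              acc-uc′ = AW.accepts-≈ (AW.accepts-complete g (target∈T (targets g g∈Tgt))) (EW.≈-sym uc′≈g)
          eq ← instance-closes ab (trP τ) acc-a
                 (g , Tgt₁⊆Tgt₂ g g∈Tgt , u , AW.reaches-from u c′ (AW.run-target acc-c) acc-uc′)
          let acc-a′ = run-mono W⊆W′ acc-a
          pure (eq , (c′ , acc-a′) , (c′ , AW′.accepts-≈ acc-a′ eq))

        simulated-suc : Simulated (suc k)
        simulated-suc (inj₁ e∈P) = do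
          (eq , (_ , acc-s) , (_ , acc-t)) ← sim e∈P
          pure (≈-mono W⊆W′ eq , (_ , run-mono W⊆W′ acc-s) , (_ , run-mono W⊆W′ acc-t))
        simulated-suc (inj₂ (_ , lr∈S , τ , τ∈T , c , c∈T , inj₁ reach , target , _ , refl , refl)) =
          new-equation (forward lr∈S) τ τ∈T c c∈T reach target
        simulated-suc (inj₂ (_ , lr∈S , τ , τ∈T , c , c∈T , inj₂ reach , target , _ , refl , refl)) = do
          (eq , acc-r , acc-l) ← new-equation (backward lr∈S) τ τ∈T c c∈T reach target
          pure (EW′.≈-sym eq , acc-l , acc-r)

      -- The first sets: Tgt₁ ⊆ Tgt₂ gives Seq Tgt₁ 0 ⊆ Seq Tgt₂ 0.
      simulated-zero : Simulated zero
      simulated-zero {s} {t} (lr , lr∈S , σ , s≡ , t≡ , (g , g∈Tgt , sub)) =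
        pure (EW.≈-axiom e∈W , (s , AW.accepts-complete s (AW.lhs∈T e∈W)) , (t , AW.accepts-complete t (AW.rhs∈T e∈W)))
        where
          module EW = Equational (Seq′ Tgt₂ zero)
          module AW = Automaton p q (Seq′ Tgt₂ zero)
          e∈W : Seq′ Tgt₂ zero (s , t)
          e∈W = lr , lr∈S , σ , s≡ , t≡ , (g , Tgt₁⊆Tgt₂ g g∈Tgt , sub)

      simulated : ∀ k → Simulated k
      simulated zero = simulated-zero
      simulated (suc k) = Consequences.simulated-suc k (simulated k)

      inclusion : ∀ k {g h} → Equational._≈_ (Seq′ Tgt₁ k) g h → ¬ ¬ (Equational._≈_ (Seq′ Tgt₂ k) g h)
      inclusion k = Consequences.transfer k (simulated k)

    TW TP TQ : G → Set
    TW g = g ≡ p ⊎ g ≡ q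
    TP g = g ≡ p
    TQ g = g ≡ q

    closed-of-same : ∀ Tgt k → SameGES Sig (Seq′ Tgt (suc k)) (Seq′ Tgt k) →
      ∀ e → Next′ Tgt (Seq′ Tgt k) e → Seq′ Tgt k e
    closed-of-same Tgt k same e next = proj₁ (same e) (inj₂ next)

    -- Soundness of the answer 'no' given in iteration k + 1: by stability the
    -- unchanged set X_k identifies p and q if S does, and W_k ⊇ X_k modulo
    -- ⇔*; but the test p ⇔*_{W_{k+1}} q failed.
    no-correct : VariablePreserving Sig S → TreeOK Sig S p q tree →
      ∀ k → ¬ YesTest Sig S p q tree (suc k) → NoTest Sig S p q tree (suc k) → ¬ p ⇔S q
    no-correct vp ok k ¬yes stop p⇔q = refute stop
      where
        module IP = Inclusion {TP} {TW} (λ g → inj₁) (λ g → inj₁) (λ j → proj₁ (proj₂ (ok j))) (λ j → proj₁ (ok j)) vp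
        module IQ = Inclusion {TQ} {TW} (λ g → inj₂) (λ g → inj₂) (λ j → proj₂ (proj₂ (ok j))) (λ j → proj₁ (ok j)) vp

        ¬p≈q : ¬ Equational._≈_ (Seq′ TW k) p q
        ¬p≈q p≈q = ¬yes (≈-mono (λ e → inj₁) p≈q)

        ¬q≈p : ¬ Equational._≈_ (Seq′ TW k) q p
        ¬q≈p q≈p = ¬p≈q (Equational.≈-sym _ q≈p)

        refute : NoTest Sig S p q tree (suc k) → ⊥
        refute (inj₁ sameW) =
          Stability.stable k (proj₁ (ok k)) (closed-of-same TW k sameW) vp (inj₁ refl) (inj₁ refl) p⇔q ¬q≈p
        refute (inj₂ (inj₁ sameP)) =
          Stability.stable k (proj₁ (proj₂ (ok k))) (closed-of-same TP k sameP) vp refl (inj₁ refl) p⇔q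
            λ q≈p → IP.inclusion k q≈p ¬q≈p
        refute (inj₂ (inj₂ sameQ)) =
          Stability.stable k (proj₂ (proj₂ (ok k))) (closed-of-same TQ k sameQ) vp refl (inj₂ refl) (⇔S-sym p⇔q)
            λ p≈q → IQ.inclusion k p≈q ¬p≈q

mainTheorem2 : (Sig : Signature) (S : TES Sig) → VariablePreserving Sig S →
    (p q : Ground Sig) (tree : TreeChoice Sig) → TreeOK Sig S p q tree →
    (OutputsYes Sig S p q tree → _⇔*[_]_ Sig p S q)
    × (OutputsNo Sig S p q tree → ¬ (_⇔*[_]_ Sig p S q))
mainTheorem2 Sig S vp p q tree ok = yes-sound , no-sound
  where
    open Theory Sig
    open Procedure S p q tree

    yes-sound : OutputsYes Sig S p q tree → p ⇔S q
    yes-sound (k , _ , p≈q) = seq-sound TW k p≈q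

    no-sound : OutputsNo Sig S p q tree → ¬ p ⇔S q
    no-sound (zero , _ , _ , ())
    no-sound (suc k , _ , ¬yes , stop) = no-correct vp ok k ¬yes stop
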